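{- Let $E$ be a finite set and let $S,S'\subseteq 2^E$ be powerful sets. If $S$ and $S'$ have the same set of minimal nonempty members (with respect to inclusion), then $S=S'$. That is, every powerful set is determined by its clutter of minimal nonempty members.
   Context: For a finite ground set $E$, a family $S\subseteq 2^E$ is called a powerful set if for every $X\subseteq E$ the number of members $Y\in S$ with $Y\cap X=\emptyset$ is a power of $2$. The minimal nonempty members of $S$ are those nonempty $Y\in S$ such that no nonempty proper subset of $Y$ belongs to $S$. -}

module Defs where

open import Data.Bool using (Bool; true; false; T)
open import Data.Bool.Properties using (T?)
open import Data.Nat using (ℕ; zero; suc; _^_)
open import Data.Product using (∃; _×_; _,_)
open import Data.List using (List; []; _∷_; _++_; map; filter; length)
open import Data.Vec using (_∷_; [])
open import Data.Fin.Subset using (Subset; _∩_; _⊂_; Nonempty; Empty; inside; outside)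
open import Data.Fin.Subset.Properties using (nonempty?)
open import Relation.Nullary using (¬_)
open import Relation.Nullary.Decidable using (¬?)
open import Relation.Binary.PropositionalEquality using (_≡_)

-- The ground set E is Fin n; subsets of E are Subset n (= Vec Bool n).
-- A family S ⊆ 2^E is given by its (Boolean) characteristic function.
Family : ℕ → Set
Family n = Subset n → Bool

_∈F_ : ∀ {n} → Subset n → Family n → Set
Y ∈F S = T (S Y)

allSubsets : ∀ n → List (Subset n)
allSubsets zero    = [] ∷ []
allSubsets (suc n) = map (outside ∷_) (allSubsets n) ++ map (inside ∷_) (allSubsets n)

countDisjoint : ∀ {n} → Family n → Subset n → ℕ
countDisjoint {n} S X =
  length (filter (λ Y → ¬? (nonempty? (Y ∩ X))) (filter (λ Y → T? (S Y)) (allSubsets n)))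

IsPowerOfTwo : ℕ → Set
IsPowerOfTwo m = ∃ λ k → m ≡ 2 ^ k

Powerful : ∀ {n} → Family n → Set
Powerful S = ∀ X → IsPowerOfTwo (countDisjoint S X)

MinimalNonempty : ∀ {n} → Family n → Subset n → Set
MinimalNonempty S Y = Y ∈F S × Nonempty Y × (∀ Z → Z ⊂ Y → Nonempty Z → ¬ (Z ∈F S))

-- Induct on Y along ⊂. Suppose S and S′ agree on the proper subsets of Y but Y ∈ S ∖ S′.
-- Taking X = ∁ Y, the members of S inside Y outnumber those of S′ by exactly one; two powers
-- of two differing by one are 2 and 1, and ∅ lies in every powerful family, so ∅ and Y are
-- the only members of S inside Y. Hence Y is minimal nonempty in S but not in S′.
module Submission where

open import Defs
open import Data.Bool using (Bool; true; false; not; _∧_; T; if_then_else_)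
open import Data.Bool.Properties using (T?; T-≡; ∧-zeroʳ) renaming (_≟_ to _≟ᵇ_)
open import Data.Empty using (⊥-elim)
open import Data.Fin.Subset
  using (Subset; _∩_; _⊂_; _⊆_; Nonempty; Empty; inside; outside; ∁; ⊥; ⊤)
open import Data.Fin.Subset.Induction using (⊂-wellFounded)
open import Data.Fin.Subset.Properties
  using (nonempty?; Empty-unique; _⊆?_; ⊆-refl; ⊥⊆; ∉⊥; ∈⊤; x∈p∩q⁺; x∈p∩q⁻;
         x∈∁p⇒x∉p; x∉∁p⇒x∈p; drop-∷-⊆; out⊂; out⊂in; s⊂s)
open import Data.List using (List; []; _∷_; _++_; map; filter; length)
open import Data.Nat using (ℕ; zero; suc; _+_; _^_; ≢-nonZero⁻¹)
open import Data.Nat.Divisibility using (_∣_; ∣m+n∣m⇒∣n; m∣m*n; ∣1⇒≡1)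
open import Data.Nat.Properties using (+-comm; +-suc; suc-injective; m^n≢0; 0≢1+n)
open import Data.Product using (_,_; proj₁)
open import Data.Vec using (_∷_; []; here)
open import Data.Vec.Properties using (≡-dec; ∷-injectiveʳ)
open import Function using (_∘_)
open import Function.Bundles using (_⇔_; Equivalence)
open import Induction.WellFounded using (module All)
open import Level using (0ℓ)
open import Relation.Binary.Definitions using (DecidableEquality)
open import Relation.Binary.PropositionalEquality
  using (_≡_; _≢_; _≗_; refl; sym; trans; cong; cong₂; subst; module ≡-Reasoning)
open import Relation.Nullary using (¬_; ¬?; yes; no; does; contradiction)
open import Relation.Unary using (Pred; Decidable)

open Equivalence using (to; from)

private
  variable
    A B : Set
    n m : ℕ

countTrue : (A → Bool) → List A → ℕ
countTrue p []       = 0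
countTrue p (x ∷ xs) = if p x then suc (countTrue p xs) else countTrue p xs

countTrue-++ : ∀ (p : A → Bool) xs ys →
               countTrue p (xs ++ ys) ≡ countTrue p xs + countTrue p ys
countTrue-++ p []       ys = refl
countTrue-++ p (x ∷ xs) ys with p x
... | true  = cong suc (countTrue-++ p xs ys)
... | false = countTrue-++ p xs ys

countTrue-map : ∀ (p : A → Bool) (f : B → A) xs →
                countTrue p (map f xs) ≡ countTrue (p ∘ f) xs
countTrue-map p f []       = refl
countTrue-map p f (x ∷ xs) with p (f x)
... | true  = cong suc (countTrue-map p f xs)
... | false = countTrue-map p f xs

countTrue-cong : ∀ {p q : A → Bool} → p ≗ q → ∀ xs → countTrue p xs ≡ countTrue q xs
countTrue-cong         p≗q []       = refl
countTrue-cong {q = q} p≗q (x ∷ xs) rewrite p≗q x =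
  cong (λ k → if q x then suc k else k) (countTrue-cong p≗q xs)

countTrue-none : ∀ {p : A → Bool} → (∀ x → p x ≡ false) → ∀ xs → countTrue p xs ≡ 0
countTrue-none none []       = refl
countTrue-none none (x ∷ xs) rewrite none x = countTrue-none none xs

length-filter-filter : ∀ {P Q : Pred A 0ℓ} (P? : Decidable P) (Q? : Decidable Q) xs →
  length (filter P? (filter Q? xs)) ≡ countTrue (λ x → does (P? x) ∧ does (Q? x)) xs
length-filter-filter P? Q? [] = refl
length-filter-filter P? Q? (x ∷ xs) with does (Q? x)
... | false rewrite ∧-zeroʳ (does (P? x)) = length-filter-filter P? Q? xs
... | true with does (P? x)
...   | true  = cong suc (length-filter-filter P? Q? xs)
...   | false = length-filter-filter P? Q? xs

card : Family n → ℕ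
card {n} S = countTrue S (allSubsets n)

card-∷ : ∀ (S : Family (suc n)) →
         card S ≡ card (S ∘ (outside ∷_)) + card (S ∘ (inside ∷_))
card-∷ {n} S =
  trans (countTrue-++ S (map (outside ∷_) (allSubsets n)) (map (inside ∷_) (allSubsets n)))
        (cong₂ _+_ (countTrue-map S (outside ∷_) (allSubsets n))
                   (countTrue-map S (inside ∷_) (allSubsets n)))

card-cong : ∀ {S S′ : Family n} → S ≗ S′ → card S ≡ card S′
card-cong {n} S≗S′ = countTrue-cong S≗S′ (allSubsets n)

card-none : ∀ {S : Family n} → (∀ Z → S Z ≡ false) → card S ≡ 0
card-none {n} none = countTrue-none none (allSubsets n)

card-one-more : ∀ {S S′ : Family n} Y → S Y ≡ true → S′ Y ≡ false →
                (∀ Z → Z ≢ Y → S Z ≡ S′ Z) → card S ≡ suc (card S′)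
card-one-more {zero} [] SY S′Y _ rewrite SY | S′Y = refl
card-one-more {suc n} {S} {S′} (outside ∷ Y) SY S′Y same = begin
  card S                                            ≡⟨ card-∷ S ⟩
  card (S ∘ (outside ∷_)) + card (S ∘ (inside ∷_))  ≡⟨ cong₂ _+_
    (card-one-more Y SY S′Y (λ Z Z≢Y → same (_ ∷ Z) (Z≢Y ∘ ∷-injectiveʳ)))
    (card-cong (λ Z → same (inside ∷ Z) λ ())) ⟩
  suc (card (S′ ∘ (outside ∷_)) + card (S′ ∘ (inside ∷_))) ≡⟨ cong suc (card-∷ S′) ⟨
  suc (card S′)                                     ∎
  where open ≡-Reasoning
card-one-more {suc n} {S} {S′} (inside ∷ Y) SY S′Y same = begin
  card S                                             ≡⟨ card-∷ S ⟩
  card (S ∘ (outside ∷_)) + card (S ∘ (inside ∷_))   ≡⟨ cong₂ _+_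
    (card-cong (λ Z → same (outside ∷ Z) λ ()))
    (card-one-more Y SY S′Y (λ Z Z≢Y → same (_ ∷ Z) (Z≢Y ∘ ∷-injectiveʳ))) ⟩
  card (S′ ∘ (outside ∷_)) + suc (card (S′ ∘ (inside ∷_))) ≡⟨ +-suc _ _ ⟩
  suc (card (S′ ∘ (outside ∷_)) + card (S′ ∘ (inside ∷_))) ≡⟨ cong suc (card-∷ S′) ⟨
  suc (card S′)                                      ∎
  where open ≡-Reasoning

_≟_ : DecidableEquality (Subset n)
_≟_ = ≡-dec _≟ᵇ_

remove : Family n → Subset n → Family n
remove S a Z with Z ≟ a
... | yes _ = false
... | no  _ = S Z

remove-≢ : ∀ (S : Family n) {a Z} → Z ≢ a → remove S a Z ≡ S Z
remove-≢ S {a} {Z} Z≢a with Z ≟ a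
... | yes Z≡a = contradiction Z≡a Z≢a
... | no  _   = refl

card-remove : ∀ {S : Family n} {a} → S a ≡ true → card S ≡ suc (card (remove S a))
card-remove {S = S} {a} Sa = card-one-more a Sa removed (λ Z Z≢a → sym (remove-≢ S Z≢a))
  where
  removed : remove S a a ≡ false
  removed with a ≟ a
  ... | yes _   = refl
  ... | no  a≢a = contradiction refl a≢a

card≡1⇒unique : ∀ {S : Family n} {a b} → card S ≡ 1 → S a ≡ true → S b ≡ true → a ≡ b
card≡1⇒unique {S = S} {a} {b} card≡1 Sa Sb with b ≟ a
... | yes b≡a = sym b≡a
... | no  b≢a = contradiction (trans (sym nothing-left) (card-remove {S = remove S a} {b} (trans (remove-≢ S b≢a) Sb))) 0≢1+n
  where
  nothing-left : card (remove S a) ≡ 0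
  nothing-left = suc-injective (trans (sym (card-remove {S = S} Sa)) card≡1)

IsPowerOfTwo⇒≢0 : IsPowerOfTwo m → m ≢ 0
IsPowerOfTwo⇒≢0 (k , refl) = ≢-nonZero⁻¹ (2 ^ k) {{m^n≢0 2 k}}

-- For larger exponents both sides are even, so 2 ∣ 1.
consecutive-powersOfTwo : IsPowerOfTwo (suc m) → IsPowerOfTwo m → m ≡ 1
consecutive-powersOfTwo _              (zero  , m≡1) = m≡1
consecutive-powersOfTwo (zero  , 1+m≡1) (suc b , m≡)  =
  contradiction (suc-injective 1+m≡1) (IsPowerOfTwo⇒≢0 (suc b , m≡))
consecutive-powersOfTwo {m} (suc a , 1+m≡) (suc b , m≡) = contradiction (∣1⇒≡1 2∣1) λ ()
  where
  2∣1 : 2 ∣ 1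
  2∣1 = ∣m+n∣m⇒∣n (subst (2 ∣_) (trans (sym 1+m≡) (+-comm 1 m)) (m∣m*n (2 ^ a)))
                   (subst (2 ∣_) (sym m≡) (m∣m*n (2 ^ b)))

⊆∧≢⇒⊂ : ∀ {p q : Subset n} → p ⊆ q → p ≢ q → p ⊂ q
⊆∧≢⇒⊂ {p = []}          {[]}          _   p≢q = contradiction refl p≢q
⊆∧≢⇒⊂ {p = outside ∷ p} {outside ∷ q} p⊆q p≢q =
  out⊂ (⊆∧≢⇒⊂ (drop-∷-⊆ p⊆q) (p≢q ∘ cong (outside ∷_)))
⊆∧≢⇒⊂ {p = outside ∷ p} {inside  ∷ q} p⊆q _   = out⊂in (drop-∷-⊆ p⊆q)
⊆∧≢⇒⊂ {p = inside  ∷ p} {outside ∷ q} p⊆q _   with p⊆q here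
... | ()
⊆∧≢⇒⊂ {p = inside  ∷ p} {inside  ∷ q} p⊆q p≢q =
  s⊂s (⊆∧≢⇒⊂ (drop-∷-⊆ p⊆q) (p≢q ∘ cong (inside ∷_)))

⊆⇒Empty-∩∁ : ∀ {p q : Subset n} → p ⊆ q → Empty (p ∩ ∁ q)
⊆⇒Empty-∩∁ {p = p} {q} p⊆q (x , x∈p∩∁q) with x∈p∩q⁻ p (∁ q) x∈p∩∁q
... | x∈p , x∈∁q = x∈∁p⇒x∉p x∈∁q (p⊆q x∈p)

Empty-∩∁⇒⊆ : ∀ {p q : Subset n} → Empty (p ∩ ∁ q) → p ⊆ q
Empty-∩∁⇒⊆ empty x∈p = x∉∁p⇒x∈p (λ x∈∁q → empty (_ , x∈p∩q⁺ (x∈p , x∈∁q)))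

Nonempty⇒≢⊥ : ∀ {p : Subset n} → Nonempty p → p ≢ ⊥
Nonempty⇒≢⊥ (x , x∈p) refl = ∉⊥ x∈p

avoiding : Subset n → Family n → Family n
avoiding X S Z = not (does (nonempty? (Z ∩ X))) ∧ S Z

countDisjoint≡card-avoiding : ∀ (S : Family n) X → countDisjoint S X ≡ card (avoiding X S)
countDisjoint≡card-avoiding {n} S X =
  length-filter-filter (λ Y → ¬? (nonempty? (Y ∩ X))) (λ Y → T? (S Y)) (allSubsets n)

avoiding-Empty : ∀ {X Z : Subset n} S → Empty (Z ∩ X) → avoiding X S Z ≡ S Z
avoiding-Empty {X = X} {Z} S empty with nonempty? (Z ∩ X)
... | yes ne = contradiction ne empty
... | no  _  = refl

avoiding-¬Empty : ∀ {X Z : Subset n} S → ¬ Empty (Z ∩ X) → avoiding X S Z ≡ false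
avoiding-¬Empty {X = X} {Z} S ¬empty with nonempty? (Z ∩ X)
... | yes _     = refl
... | no  empty = contradiction empty ¬empty

-- Only ∅ avoids ⊤, and countDisjoint S ⊤ is a power of two, hence positive.
∅∈powerful : ∀ {S : Family n} → Powerful S → S ⊥ ≡ true
∅∈powerful {S = S} P with S ⊥ in S⊥≡false
... | true  = refl
... | false = contradiction (trans (countDisjoint≡card-avoiding S ⊤) (card-none only-∅))
                            (IsPowerOfTwo⇒≢0 (P ⊤))
  where
  only-∅ : ∀ Z → avoiding ⊤ S Z ≡ false
  only-∅ Z with nonempty? Z
  ... | yes (x , x∈Z) = avoiding-¬Empty S (λ empty → empty (x , x∈p∩q⁺ (x∈Z , ∈⊤)))
  ... | no  empty rewrite Empty-unique empty = trans (cong (_ ∧_) S⊥≡false) (∧-zeroʳ _)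

lone-disagreement⇒MinimalNonempty : ∀ {S S′ : Family n} {Y} → Powerful S → Powerful S′ →
  (∀ {Z} → Z ⊂ Y → S Z ≡ S′ Z) → S Y ≡ true → S′ Y ≡ false → MinimalNonempty S Y
lone-disagreement⇒MinimalNonempty {S = S} {S′} {Y} P P′ agree Y∈S Y∉S′ =
  from T-≡ Y∈S , Y-nonempty , no-smaller-member
  where
  inside-Y : ∀ T {Z} → Z ⊆ Y → avoiding (∁ Y) T Z ≡ T Z
  inside-Y T = avoiding-Empty T ∘ ⊆⇒Empty-∩∁

  outside-Y : ∀ T {Z} → ¬ Z ⊆ Y → avoiding (∁ Y) T Z ≡ false
  outside-Y T Z⊈Y = avoiding-¬Empty T (Z⊈Y ∘ Empty-∩∁⇒⊆)

  same-off-Y : ∀ Z → Z ≢ Y → avoiding (∁ Y) S Z ≡ avoiding (∁ Y) S′ Z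
  same-off-Y Z Z≢Y with Z ⊆? Y
  ... | yes Z⊆Y = trans (inside-Y S Z⊆Y)
                        (trans (agree (⊆∧≢⇒⊂ Z⊆Y Z≢Y)) (sym (inside-Y S′ Z⊆Y)))
  ... | no  Z⊈Y = trans (outside-Y S Z⊈Y) (sym (outside-Y S′ Z⊈Y))

  one-more : card (avoiding (∁ Y) S) ≡ suc (card (avoiding (∁ Y) S′))
  one-more = card-one-more Y (trans (inside-Y S ⊆-refl) Y∈S)
                             (trans (inside-Y S′ ⊆-refl) Y∉S′) same-off-Y

  just-one : card (avoiding (∁ Y) S′) ≡ 1
  just-one = consecutive-powersOfTwo
    (subst IsPowerOfTwo (trans (countDisjoint≡card-avoiding S (∁ Y)) one-more) (P (∁ Y)))
    (subst IsPowerOfTwo (countDisjoint≡card-avoiding S′ (∁ Y)) (P′ (∁ Y)))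

  ∅∈S′ : S′ ⊥ ≡ true
  ∅∈S′ = ∅∈powerful P′

  Y-nonempty : Nonempty Y
  Y-nonempty with nonempty? Y
  ... | yes Y≠∅ = Y≠∅
  ... | no  empty with trans (sym ∅∈S′) (subst (λ W → S′ W ≡ false) (Empty-unique empty) Y∉S′)
  ...   | ()

  no-smaller-member : ∀ Z → Z ⊂ Y → Nonempty Z → ¬ Z ∈F S
  no-smaller-member Z Z⊂Y Z≠∅ Z∈S = Nonempty⇒≢⊥ Z≠∅
    (card≡1⇒unique {S = avoiding (∁ Y) S′} just-one
      (trans (inside-Y S′ (proj₁ Z⊂Y)) (trans (sym (agree Z⊂Y)) (to T-≡ Z∈S)))
      (trans (inside-Y S′ ⊥⊆) ∅∈S′))

theorem12 : (n : ℕ) (S S′ : Family n) → Powerful S → Powerful S′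
    → (∀ Y → MinimalNonempty S Y ⇔ MinimalNonempty S′ Y)
    → ∀ (Y : Subset n) → S Y ≡ S′ Y
theorem12 n S S′ P P′ M = All.wfRec ⊂-wellFounded _ (λ Y → S Y ≡ S′ Y) agree-on
  where
  agree-on : ∀ Y → (∀ {Z} → Z ⊂ Y → S Z ≡ S′ Z) → S Y ≡ S′ Y
  agree-on Y agree with S Y in SY | S′ Y in S′Y
  ... | true  | true  = refl
  ... | false | false = refl
  ... | true  | false = ⊥-elim (subst T S′Y (proj₁ (to (M Y)
          (lone-disagreement⇒MinimalNonempty P P′ agree SY S′Y))))
  ... | false | true  = ⊥-elim (subst T SY (proj₁ (from (M Y)
          (lone-disagreement⇒MinimalNonempty P′ P (sym ∘ agree) S′Y SY))))
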